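{- If two words $u$ and $v$ over a totally ordered alphabet are L-adjacent, then the nondecreasing rearrangements of their Lehmer codes are equal.
   Context: The Lehmer code of a word $w=w_1\cdots w_n$ is $\operatorname{Lc}(w)=(c_1,\ldots,c_n)$ with $c_i=\#\{j>i: w_j<w_i\}$. Two words $u,v$ are L-adjacent if there exist words $w_1,w_2,w_3,w_4$ and letters $a<b<c$ such that $u=w_1\,a\,w_2\,c\,w_3\,b\,w_4$ and $v=w_1\,b\,w_2\,a\,w_3\,c\,w_4$, where all letters of $w_2$ are greater than $b$, and all letters of $w_3$ and $w_4$ are either smaller than $b$ or greater than $c$. -}

module Defs where

open import Level using (Level; _⊔_)
open import Data.Nat using (ℕ)
open import Data.Nat.Properties using (≤-decTotalOrder)
open import Data.List using (List; []; _∷_; _++_; length; filter)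
open import Data.List.Relation.Unary.All using (All)
open import Data.Product using (∃-syntax; _×_)
open import Data.Sum using (_⊎_)
open import Relation.Binary.Bundles using (StrictTotalOrder)
open import Relation.Binary.PropositionalEquality using (_≡_)
import Data.List.Sort

sortℕ : List ℕ → List ℕ
sortℕ = Data.List.Sort.sort ≤-decTotalOrder

module _ {a ℓ₁ ℓ₂ : Level} (O : StrictTotalOrder a ℓ₁ ℓ₂) where
  open StrictTotalOrder O renaming (Carrier to A)

  lehmer : List A → List ℕ
  lehmer []       = []
  lehmer (x ∷ xs) = length (filter (λ y → y <? x) xs) ∷ lehmer xs

  LAdjacent : List A → List A → Set (a ⊔ ℓ₂)
  LAdjacent u v =
    ∃[ w₁ ] ∃[ w₂ ] ∃[ w₃ ] ∃[ w₄ ] ∃[ x ] ∃[ y ] ∃[ z ]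
      ( x < y × y < z
      × u ≡ w₁ ++ x ∷ w₂ ++ z ∷ w₃ ++ y ∷ w₄
      × v ≡ w₁ ++ y ∷ w₂ ++ x ∷ w₃ ++ z ∷ w₄
      × All (λ t → y < t) w₂
      × All (λ t → t < y ⊎ z < t) w₃
      × All (λ t → t < y ⊎ z < t) w₄ )

-- Write u = w₁ x w₂ z w₃ y w₄ and v = w₁ y w₂ x w₃ z w₄ with x < y < z.  The Lehmer entries
-- at w₁ only see the remaining letters up to permutation, and the entries at w₂, w₃, w₄ are
-- unchanged because x, y lie below every letter of w₂ while y, z lie on the same side of
-- every letter of w₃ w₄.  The entry of x is the same in both words, and the entry of z in u
-- equals that of y in v, so the two Lehmer codes differ by a transposition.
module Submission where

open import Defs
open import Level using (Level)
open import Data.Nat using (ℕ; suc; _+_)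
open import Data.Nat.Properties using (≤-decTotalOrder; ≤-totalOrder)
open import Data.List using (List; []; _∷_; _++_; length; filter)
open import Data.List.Properties using (length-++; filter-++; filter-none; filter-accept; filter-reject)
open import Data.List.Relation.Unary.All using (All; []; _∷_; universal)
import Data.List.Relation.Unary.All as All
open import Data.List.Relation.Unary.All.Properties using (++⁺)
open import Data.List.Relation.Binary.Permutation.Propositional
  using (_↭_; ↭⇒↭ₛ; prep; swap; ↭-sym; ↭-refl; ↭-trans)
open import Data.List.Relation.Binary.Permutation.Propositional.Properties
  using (shift; ++⁺ˡ; filter-↭; ↭-length)
open import Data.List.Relation.Binary.Pointwise using (Pointwise-≡⇒≡)
import Data.List.Relation.Unary.Sorted.TotalOrder.Properties as Sorted
import Data.List.Sort
open import Data.Product using (∃-syntax; _×_; _,_)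
open import Data.Sum using (_⊎_; inj₁; inj₂)
open import Relation.Nullary using (¬_)
open import Relation.Binary.Bundles using (StrictTotalOrder)
open import Relation.Binary.PropositionalEquality
  using (_≡_; refl; sym; trans; cong; cong₂; module ≡-Reasoning)

sortℕ-↭ : ∀ {xs ys} → xs ↭ ys → sortℕ xs ≡ sortℕ ys
sortℕ-↭ {xs} {ys} xs↭ys =
  Pointwise-≡⇒≡ (Sorted.↗↭↗⇒≋ ≤-totalOrder (sort-↗ xs) (sort-↗ ys)
    (↭⇒↭ₛ (↭-trans (sort-↭ xs) (↭-trans xs↭ys (↭-sym (sort-↭ ys))))))
  where open Data.List.Sort ≤-decTotalOrder

module _ {ℓ : Level} {A : Set ℓ} where

  ↭-transpose : ∀ (x y : A) xs ys → x ∷ xs ++ y ∷ ys ↭ y ∷ xs ++ x ∷ ys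
  ↭-transpose x y xs ys =
    ↭-trans (prep x (shift y xs ys))
      (↭-trans (swap x y ↭-refl) (prep y (↭-sym (shift x xs ys))))

  Transposition : List A → List A → Set ℓ
  Transposition k l = ∃[ xs ] ∃[ ys ] ∃[ zs ] ∃[ x ] ∃[ y ]
    (k ≡ xs ++ x ∷ ys ++ y ∷ zs × l ≡ xs ++ y ∷ ys ++ x ∷ zs)

  Transposition⇒↭ : ∀ {k l} → Transposition k l → k ↭ l
  Transposition⇒↭ (xs , ys , zs , x , y , refl , refl) = ++⁺ˡ xs (↭-transpose x y ys zs)

module _ {a ℓ₁ ℓ₂ : Level} (O : StrictTotalOrder a ℓ₁ ℓ₂) where
  open StrictTotalOrder O renaming (Carrier to A; trans to <-trans)

  countBelow : A → List A → ℕ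
  countBelow x xs = length (filter (_<? x) xs)

  countBelow-↭ : ∀ {x xs ys} → xs ↭ ys → countBelow x xs ≡ countBelow x ys
  countBelow-↭ xs↭ys = ↭-length (filter-↭ _ xs↭ys)

  countBelow-++ : ∀ x xs ys → countBelow x (xs ++ ys) ≡ countBelow x xs + countBelow x ys
  countBelow-++ x xs ys = trans (cong length (filter-++ (_<? x) xs ys)) (length-++ (filter (_<? x) xs))

  countBelow-++-≮ : ∀ {x} xs {ys} → All (λ t → ¬ t < x) xs → countBelow x (xs ++ ys) ≡ countBelow x ys
  countBelow-++-≮ {x} xs {ys} xs≮x =
    trans (countBelow-++ x xs ys) (cong (λ xs′ → length xs′ + countBelow x ys) (filter-none (_<? x) xs≮x))

  countBelow-∷-< : ∀ {x t xs} → t < x → countBelow x (t ∷ xs) ≡ suc (countBelow x xs)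
  countBelow-∷-< t<x = cong length (filter-accept (_<? _) t<x)

  countBelow-∷-≮ : ∀ {x t xs} → ¬ t < x → countBelow x (t ∷ xs) ≡ countBelow x xs
  countBelow-∷-≮ t≮x = cong length (filter-reject (_<? _) t≮x)

  Outside : A → A → A → Set ℓ₂
  Outside y z t = t < y ⊎ z < t

  countBelow-outside : ∀ {y z} → y < z → ∀ {xs} → All (Outside y z) xs → countBelow y xs ≡ countBelow z xs
  countBelow-outside y<z [] = refl
  countBelow-outside y<z (inj₁ t<y ∷ out) =
    trans (countBelow-∷-< t<y)
      (trans (cong suc (countBelow-outside y<z out)) (sym (countBelow-∷-< (<-trans t<y y<z))))
  countBelow-outside y<z (inj₂ z<t ∷ out) =
    trans (countBelow-∷-≮ (λ t<y → asym z<t (<-trans t<y y<z)))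
      (trans (countBelow-outside y<z out) (sym (countBelow-∷-≮ (asym z<t))))

  lehmerOver : List A → List A → List ℕ
  lehmerOver []      r = []
  lehmerOver (t ∷ w) r = countBelow t (w ++ r) ∷ lehmerOver w r

  lehmer-++ : ∀ w r → lehmer O (w ++ r) ≡ lehmerOver w r ++ lehmer O r
  lehmer-++ []      r = refl
  lehmer-++ (t ∷ w) r = cong (countBelow t (w ++ r) ∷_) (lehmer-++ w r)

  lehmerOver-cong : ∀ {r r′} w → All (λ t → countBelow t r ≡ countBelow t r′) w →
                    lehmerOver w r ≡ lehmerOver w r′
  lehmerOver-cong []      []       = refl
  lehmerOver-cong {r} {r′} (t ∷ w) (eq ∷ eqs) =
    cong₂ _∷_ (trans (countBelow-++ t w r) (trans (cong (countBelow t w +_) eq) (sym (countBelow-++ t w r′))))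
              (lehmerOver-cong w eqs)

  lehmerOver-↭ : ∀ {r r′} w → r ↭ r′ → lehmerOver w r ≡ lehmerOver w r′
  lehmerOver-↭ w r↭r′ = lehmerOver-cong w (universal (λ _ → countBelow-↭ r↭r′) w)

  lehmer-split : ∀ w₁ p w₂ q w₃ s w₄ →
    lehmer O (w₁ ++ p ∷ w₂ ++ q ∷ w₃ ++ s ∷ w₄)
      ≡ lehmerOver w₁ (p ∷ w₂ ++ q ∷ w₃ ++ s ∷ w₄) ++ countBelow p (w₂ ++ q ∷ w₃ ++ s ∷ w₄)
        ∷ lehmerOver w₂ (q ∷ w₃ ++ s ∷ w₄) ++ countBelow q (w₃ ++ s ∷ w₄)
        ∷ lehmerOver w₃ (s ∷ w₄) ++ countBelow s w₄ ∷ lehmer O w₄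
  lehmer-split w₁ p w₂ q w₃ s w₄
    rewrite lehmer-++ w₁ (p ∷ w₂ ++ q ∷ w₃ ++ s ∷ w₄)
          | lehmer-++ w₂ (q ∷ w₃ ++ s ∷ w₄)
          | lehmer-++ w₃ (s ∷ w₄) = refl

  module Adjacent {x y z : A} (x<y : x < y) (y<z : y < z) {w₂ w₃ w₄ : List A}
    (above : All (y <_) w₂) (out₃ : All (Outside y z) w₃) (out₄ : All (Outside y z) w₄) where
    open ≡-Reasoning

    tail-↭ : x ∷ w₂ ++ z ∷ w₃ ++ y ∷ w₄ ↭ y ∷ w₂ ++ x ∷ w₃ ++ z ∷ w₄
    tail-↭ = ↭-trans (prep x (++⁺ˡ w₂ (↭-transpose z y w₃ w₄))) (↭-transpose x y w₂ (w₃ ++ z ∷ w₄))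

    countBelow-first : countBelow x (w₂ ++ z ∷ w₃ ++ y ∷ w₄) ≡ countBelow x (w₃ ++ z ∷ w₄)
    countBelow-first = begin
      countBelow x (w₂ ++ z ∷ w₃ ++ y ∷ w₄) ≡⟨ countBelow-++-≮ w₂ (All.map (λ y<t t<x → asym y<t (<-trans t<x x<y)) above) ⟩
      countBelow x (z ∷ w₃ ++ y ∷ w₄)       ≡⟨ countBelow-↭ (↭-transpose z y w₃ w₄) ⟩
      countBelow x (y ∷ w₃ ++ z ∷ w₄)       ≡⟨ countBelow-∷-≮ (asym x<y) ⟩
      countBelow x (w₃ ++ z ∷ w₄)           ∎

    countBelow-moved : countBelow z (w₃ ++ y ∷ w₄) ≡ countBelow y (w₂ ++ x ∷ w₃ ++ z ∷ w₄)
    countBelow-moved = begin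
      countBelow z (w₃ ++ y ∷ w₄)           ≡⟨ countBelow-↭ (shift y w₃ w₄) ⟩
      countBelow z (y ∷ w₃ ++ w₄)           ≡⟨ countBelow-∷-< y<z ⟩
      suc (countBelow z (w₃ ++ w₄))         ≡⟨ cong suc (countBelow-outside y<z (++⁺ out₃ out₄)) ⟨
      suc (countBelow y (w₃ ++ w₄))         ≡⟨ cong suc (countBelow-∷-≮ (asym y<z)) ⟨
      suc (countBelow y (z ∷ w₃ ++ w₄))     ≡⟨ cong suc (countBelow-↭ (shift z w₃ w₄)) ⟨
      suc (countBelow y (w₃ ++ z ∷ w₄))     ≡⟨ countBelow-∷-< x<y ⟨
      countBelow y (x ∷ w₃ ++ z ∷ w₄)       ≡⟨ countBelow-++-≮ w₂ (All.map asym above) ⟨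
      countBelow y (w₂ ++ x ∷ w₃ ++ z ∷ w₄) ∎

    lehmerOver-above : lehmerOver w₂ (z ∷ w₃ ++ y ∷ w₄) ≡ lehmerOver w₂ (x ∷ w₃ ++ z ∷ w₄)
    lehmerOver-above = lehmerOver-cong w₂ (All.map same above)
      where
      same : ∀ {t} → y < t → countBelow t (z ∷ w₃ ++ y ∷ w₄) ≡ countBelow t (x ∷ w₃ ++ z ∷ w₄)
      same {t} y<t = begin
        countBelow t (z ∷ w₃ ++ y ∷ w₄) ≡⟨ countBelow-↭ (↭-transpose z y w₃ w₄) ⟩
        countBelow t (y ∷ w₃ ++ z ∷ w₄) ≡⟨ countBelow-∷-< y<t ⟩
        suc (countBelow t (w₃ ++ z ∷ w₄)) ≡⟨ countBelow-∷-< (<-trans x<y y<t) ⟨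
        countBelow t (x ∷ w₃ ++ z ∷ w₄) ∎

    lehmerOver-outside : lehmerOver w₃ (y ∷ w₄) ≡ lehmerOver w₃ (z ∷ w₄)
    lehmerOver-outside = lehmerOver-cong w₃ (All.map same out₃)
      where
      same : ∀ {t} → Outside y z t → countBelow t (y ∷ w₄) ≡ countBelow t (z ∷ w₄)
      same (inj₁ t<y) = trans (countBelow-∷-≮ (asym t<y)) (sym (countBelow-∷-≮ (asym (<-trans t<y y<z))))
      same (inj₂ z<t) = trans (countBelow-∷-< (<-trans y<z z<t)) (sym (countBelow-∷-< z<t))

  lehmer-transposition : ∀ {u v} → LAdjacent O u v → Transposition (lehmer O u) (lehmer O v)
  lehmer-transposition (w₁ , w₂ , w₃ , w₄ , x , y , z , x<y , y<z , refl , refl , above , out₃ , out₄) =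
    L₁ , L₂ , L₃ , countBelow x (w₂ ++ z ∷ w₃ ++ y ∷ w₄) , countBelow z (w₃ ++ y ∷ w₄) ,
    lehmer-split w₁ x w₂ z w₃ y w₄ ,
    trans (lehmer-split w₁ y w₂ x w₃ z w₄)
      (sym (cong₂ _++_ (lehmerOver-↭ w₁ tail-↭) (cong₂ _∷_ countBelow-moved
        (cong₂ _++_ lehmerOver-above (cong₂ _∷_ countBelow-first
          (cong₂ _++_ lehmerOver-outside (cong (_∷ lehmer O w₄) (countBelow-outside y<z out₄))))))))
    where
    open Adjacent x<y y<z above out₃ out₄
    L₁ L₂ L₃ : List ℕ
    L₁ = lehmerOver w₁ (x ∷ w₂ ++ z ∷ w₃ ++ y ∷ w₄)
    L₂ = lehmerOver w₂ (z ∷ w₃ ++ y ∷ w₄)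
    L₃ = lehmerOver w₃ (y ∷ w₄) ++ countBelow y w₄ ∷ lehmer O w₄

mainTheorem16 : {a ℓ₁ ℓ₂ : Level} (O : StrictTotalOrder a ℓ₁ ℓ₂)
    (u v : List (StrictTotalOrder.Carrier O)) →
    LAdjacent O u v → sortℕ (lehmer O u) ≡ sortℕ (lehmer O v)
mainTheorem16 O u v adjacent = sortℕ-↭ (Transposition⇒↭ (lehmer-transposition O adjacent))
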